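{- Let $G$ be a vertex-colored graph satisfying Conditions A–F listed in the context. Then every anisotropic component $A$ of the cell graph $C(G)$ satisfies: (G) $A$ is a tree, and if $R$ is a cell of $A$ of minimum cardinality and $A_R$ is the rooted directed tree obtained by rooting $A$ at $R$ (edges directed away from $R$), then $|X|\le|Y|$ for every directed edge $(X,Y)$ of $A_R$; (H) $A$ contains at most one heterogeneous vertex, and if $R$ is such a vertex then $R$ has minimum cardinality among the cells of $A$.
   Context: A vertex-colored graph is a finite simple undirected graph with a coloring $c:V(G)\to\{1,\dots,k\}$. Color refinement: $C^0(u)=c(u)$, $C^{i+1}(u)=(C^i(u),\{\!\{C^i(a): a\in N(u)\}\!\})$; the partitions into color classes stabilize to the stable partition $\mathcal{P}_G$ (elements called cells). $G[X]$ is the induced subgraph; $G[X,Y]$ is the bipartite graph of edges between disjoint $X,Y$; bipartite complement has the same parts and the complementary edges between them. Cell graph $C(G)$: complete graph on $\mathcal{P}_G$. Cell $X$ is homogeneous if $G[X]$ is complete or empty, heterogeneous otherwise; edge $\{X,Y\}$ is isotropic if $G[X,Y]$ is complete bipartite or empty, anisotropic otherwise. Anisotropic path/cycle: all edges anisotropic; uniform: all cells of equal cardinality. An anisotropic component is a maximal connected subgraph of $C(G)$ with only anisotropic edges (possibly a single vertex). Conditions: (A) for each cell $X$, $G[X]$ is empty, complete, a matching $mK_2$, the complement of a matching, or $C_5$. (B) for distinct cells $X,Y$, $G[X,Y]$ is empty, complete bipartite, a disjoint union of stars $sK_{1,t}$ with one of $X,Y$ the $s$ centers and the other the $st$ leaves,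 or the bipartite complement of such. (C) no uniform anisotropic path connects two heterogeneous cells. (D) no uniform anisotropic cycle. (E) no anisotropic path $XY_1\ldots Y_lZ$ with $|X|<|Y_1|=\dots=|Y_l|>|Z|$ and no anisotropic cycle $XY_1\ldots Y_lX$ with $|X|<|Y_1|=\dots=|Y_l|$. (F) no anisotropic path $XY_1\ldots Y_l$ with $|X|<|Y_1|=\dots=|Y_l|$ and $Y_l$ heterogeneous. -}

module Defs where

open import Data.Nat using (ℕ; zero; suc; _+_; _≤_; _<_; _≡ᵇ_)
open import Data.Nat.DivMod using (_%_)
open import Data.Fin using (Fin; zero; suc; toℕ; fromℕ; inject₁) renaming (_≟_ to _≟ᶠ_)
open import Data.Bool using (Bool; true; false; _∧_; if_then_else_)
open import Data.Product using (Σ; ∃; ∃-syntax; _×_; _,_)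
open import Data.Sum using (_⊎_)
open import Data.Empty using (⊥)
open import Data.Unit using (⊤)
open import Relation.Nullary using (¬_)
open import Relation.Nullary.Decidable using (⌊_⌋)
open import Relation.Binary.PropositionalEquality using (_≡_; _≢_)
open import Function.Bundles using (_⇔_)
open import Function.Definitions using (Injective)

countF : ∀ {m} → (Fin m → Bool) → ℕ
countF {zero} f = 0
countF {suc m} f = (if f zero then 1 else 0) + countF (λ i → f (suc i))

allF : ∀ {m} → (Fin m → Bool) → Bool
allF {zero} f = true
allF {suc m} f = f zero ∧ allF (λ i → f (suc i))

record ColoredGraph : Set where
  field
    n          : ℕ
    k          : ℕ
    adj        : Fin n → Fin n → Bool
    adj-sym    : ∀ u v → adj u v ≡ adj v u
    adj-irrefl : ∀ u → adj u u ≡ false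
    col        : Fin n → Fin k

EmptyG : ∀ {m} → Fin m → Fin m → Set
EmptyG _ _ = ⊥

CompleteG : ∀ {m} → Fin m → Fin m → Set
CompleteG a b = a ≢ b

MatchingG : ∀ {m} → Fin m × Fin 2 → Fin m × Fin 2 → Set
MatchingG (i , a) (j , b) = i ≡ j × a ≢ b

CoMatchingG : ∀ {m} → Fin m × Fin 2 → Fin m × Fin 2 → Set
CoMatchingG (i , a) (j , b) = i ≢ j

C5G : Fin 5 → Fin 5 → Set
C5G a b = (toℕ b ≡ (toℕ a + 1) % 5) ⊎ (toℕ a ≡ (toℕ b + 1) % 5)

EmptyBip : ∀ {p q} → Fin p → Fin q → Set
EmptyBip _ _ = ⊥

CompleteBip : ∀ {p q} → Fin p → Fin q → Set
CompleteBip _ _ = ⊤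

-- s K_{1,t}: centers Fin s, leaves Fin s × Fin t, center c adjacent to leaf (i,j) iff c = i
StarsCL : ∀ {s t} → Fin s → Fin s × Fin t → Set
StarsCL c (i , j) = c ≡ i

StarsLC : ∀ {s t} → Fin s × Fin t → Fin s → Set
StarsLC (i , j) c = c ≡ i

CoStarsCL : ∀ {s t} → Fin s → Fin s × Fin t → Set
CoStarsCL c (i , j) = ¬ (c ≡ i)

CoStarsLC : ∀ {s t} → Fin s × Fin t → Fin s → Set
CoStarsLC (i , j) c = ¬ (c ≡ i)

module _ (G : ColoredGraph) where
  open ColoredGraph G

  Adj : Fin n → Fin n → Set
  Adj u v = adj u v ≡ true

  -- refine i u v = true  iff  C^i(u) = C^i(v)   (color refinement).
  -- Equality of the multisets {{C^i(a) : a ∈ N(u)}} and {{C^i(a) : a ∈ N(v)}}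
  -- is expressed by equality of multiplicities of every realized color C^i(w).
  refine : ℕ → Fin n → Fin n → Bool
  refine zero    u v = ⌊ col u ≟ᶠ col v ⌋
  refine (suc i) u v =
    refine i u v ∧
    allF (λ w → countF (λ a → adj u a ∧ refine i a w)
                ≡ᵇ countF (λ a → adj v a ∧ refine i a w))

  -- The stable partition: the refinement sequence stabilizes after at most
  -- n rounds, so the stable partition is the partition after n rounds.
  SameCell : Fin n → Fin n → Bool
  SameCell = refine n

  _∈ᶜ_ : Fin n → Fin n → Set
  u ∈ᶜ x = SameCell x u ≡ true

  -- cells are represented by any of their vertices; distinct cells:
  DistinctCells : Fin n → Fin n → Set
  DistinctCells x y = SameCell x y ≡ false

  ∣_∣ᶜ : Fin n → ℕ
  ∣ x ∣ᶜ = countF (SameCell x)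

  Enumerates : {A : Set} → (A → Fin n) → Fin n → Set
  Enumerates f x = Injective _≡_ _≡_ f × (∀ u → (u ∈ᶜ x) ⇔ (∃[ a ] f a ≡ u))

  InducedIso : {A : Set} → Fin n → (A → A → Set) → Set
  InducedIso {A} x R = Σ (A → Fin n) λ f → Enumerates f x × (∀ a b → Adj (f a) (f b) ⇔ R a b)

  BipIso : {A B : Set} → Fin n → Fin n → (A → B → Set) → Set
  BipIso {A} {B} x y R =
    Σ (A → Fin n) λ f → Σ (B → Fin n) λ g →
      Enumerates f x × Enumerates g y × (∀ a b → Adj (f a) (g b) ⇔ R a b)

  Homogeneous : Fin n → Set
  Homogeneous x =
    (∀ u v → u ∈ᶜ x → v ∈ᶜ x → u ≢ v → Adj u v) ⊎
    (∀ u v → u ∈ᶜ x → v ∈ᶜ x → adj u v ≡ false)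

  Heterogeneous : Fin n → Set
  Heterogeneous x = ¬ Homogeneous x

  Isotropic : Fin n → Fin n → Set
  Isotropic x y =
    (∀ u v → u ∈ᶜ x → v ∈ᶜ y → Adj u v) ⊎
    (∀ u v → u ∈ᶜ x → v ∈ᶜ y → adj u v ≡ false)

  Aniso : Fin n → Fin n → Set
  Aniso x y = DistinctCells x y × ¬ Isotropic x y

  AnisoPath : ∀ {m} → (Fin (suc m) → Fin n) → Set
  AnisoPath {m} p =
    (∀ i j → i ≢ j → DistinctCells (p i) (p j)) ×
    (∀ (i : Fin m) → Aniso (p (inject₁ i)) (p (suc i)))

  -- anisotropic cycle Z₀ Z₁ … Z_m Z₀ (at least 3 distinct cells)
  AnisoCycle : ∀ {m} → (Fin (suc m) → Fin n) → Set
  AnisoCycle {m} p = 2 ≤ m × AnisoPath p × Aniso (p (fromℕ m)) (p zero)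

  Uniform : ∀ {m} → (Fin (suc m) → Fin n) → Set
  Uniform p = ∀ i j → ∣ p i ∣ᶜ ≡ ∣ p j ∣ᶜ

  Interior : (m : ℕ) → Fin (suc m) → Set
  Interior m i = 0 < toℕ i × toℕ i < m

  CondA : Set
  CondA = ∀ x →
    (∃[ m ] InducedIso {Fin m} x EmptyG) ⊎
    (∃[ m ] InducedIso {Fin m} x CompleteG) ⊎
    (∃[ m ] InducedIso {Fin m × Fin 2} x MatchingG) ⊎
    (∃[ m ] InducedIso {Fin m × Fin 2} x CoMatchingG) ⊎
    InducedIso x C5G

  CondB : Set
  CondB = ∀ x y → DistinctCells x y →
    (∃[ p ] ∃[ q ] BipIso {Fin p} {Fin q} x y EmptyBip) ⊎
    (∃[ p ] ∃[ q ] BipIso {Fin p} {Fin q} x y CompleteBip) ⊎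
    (∃[ s ] ∃[ t ] BipIso {Fin s} {Fin s × Fin t} x y StarsCL) ⊎
    (∃[ s ] ∃[ t ] BipIso {Fin s × Fin t} {Fin s} x y StarsLC) ⊎
    (∃[ s ] ∃[ t ] BipIso {Fin s} {Fin s × Fin t} x y CoStarsCL) ⊎
    (∃[ s ] ∃[ t ] BipIso {Fin s × Fin t} {Fin s} x y CoStarsLC)

  CondC : Set
  CondC = ∀ m (p : Fin (suc m) → Fin n) → 1 ≤ m → AnisoPath p → Uniform p →
    Heterogeneous (p zero) → Heterogeneous (p (fromℕ m)) → ⊥

  CondD : Set
  CondD = ∀ m (p : Fin (suc m) → Fin n) → AnisoCycle p → Uniform p → ⊥

  -- path X Y₁ … Y_l Z  (l ≥ 1, so m = l + 1 ≥ 2)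
  CondE-path : Set
  CondE-path = ∀ m (p : Fin (suc m) → Fin n) → 2 ≤ m → AnisoPath p →
    (∀ i j → Interior m i → Interior m j → ∣ p i ∣ᶜ ≡ ∣ p j ∣ᶜ) →
    (∀ i → Interior m i → ∣ p zero ∣ᶜ < ∣ p i ∣ᶜ) →
    (∀ i → Interior m i → ∣ p (fromℕ m) ∣ᶜ < ∣ p i ∣ᶜ) → ⊥

  CondE-cycle : Set
  CondE-cycle = ∀ m (p : Fin (suc m) → Fin n) → AnisoCycle p →
    (∀ i j → i ≢ zero → j ≢ zero → ∣ p i ∣ᶜ ≡ ∣ p j ∣ᶜ) →
    (∀ i → i ≢ zero → ∣ p zero ∣ᶜ < ∣ p i ∣ᶜ) → ⊥

  CondE : Set
  CondE = CondE-path × CondE-cycle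

  CondF : Set
  CondF = ∀ m (p : Fin (suc m) → Fin n) → 1 ≤ m → AnisoPath p →
    (∀ i j → i ≢ zero → j ≢ zero → ∣ p i ∣ᶜ ≡ ∣ p j ∣ᶜ) →
    (∀ i → i ≢ zero → ∣ p zero ∣ᶜ < ∣ p i ∣ᶜ) →
    Heterogeneous (p (fromℕ m)) → ⊥

  -- Anisotropic components: the component of the cell of r consists of
  -- the cells reachable from r along anisotropic edges.

  data Reach (r : Fin n) : Fin n → Set where
    here : ∀ {x} → x ∈ᶜ r → Reach r x
    step : ∀ {x y} → Reach r x → Aniso x y → Reach r y

  IsTreeComp : Fin n → Set
  IsTreeComp r =
    (∀ x y → Reach r x → Reach r y → Reach x y) ×
    (∀ m (p : Fin (suc m) → Fin n) → AnisoCycle p → (∀ i → Reach r (p i)) → ⊥)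

  -- (X,Y) is a directed edge of the tree rooted at R: there is an anisotropic
  -- path from R whose last edge is X Y
  RootedEdge : Fin n → Fin n → Fin n → Set
  RootedEdge R x y = ∃[ m ] Σ (Fin (suc (suc m)) → Fin n) λ p →
    AnisoPath p × (p zero ∈ᶜ R) ×
    (p (inject₁ (fromℕ m)) ∈ᶜ x) × (p (fromℕ (suc m)) ∈ᶜ y)

  CondG : Fin n → Set
  CondG r =
    IsTreeComp r ×
    (∀ R → Reach r R → (∀ x → Reach r x → ∣ R ∣ᶜ ≤ ∣ x ∣ᶜ) →
       ∀ x y → RootedEdge R x y → ∣ x ∣ᶜ ≤ ∣ y ∣ᶜ)

  CondH : Fin n → Set
  CondH r =
    (∀ x y → Reach r x → Reach r y → Heterogeneous x → Heterogeneous y → y ∈ᶜ x) ×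
    (∀ R → Reach r R → Heterogeneous R → ∀ x → Reach r x → ∣ R ∣ᶜ ≤ ∣ x ∣ᶜ)

module Submission where

-- The whole argument is about the sequence of cell sizes along a simple anisotropic
-- path.  Condition E-path forbids a strict "peak" on such a path (a run of equal sizes
-- strictly above both neighbouring sizes).  A purely combinatorial lemma ('profile')
-- shows that a peak-free sequence f on [0, L] has its maximum at 0, or rises strictly
-- into a final run of maximal values ending at L.  From this:
--   * a heterogeneous cell R is minimal: on a path from x to R a final rise into R is
--     excluded by F, so the maximum is at x and |R| ≤ |x|;
--   * two heterogeneous cells coincide: the path between them would be uniform (C);
--   * sizes grow along rooted edges: the maximum of a path from the root sits at an end;
--   * there is no cycle: rotate a smallest cell to the front; the final rise of the
--     path around the cycle gives a uniform cycle (D), a cycle of type E, or, via the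
--     closing edge, a peak (E-path).

open import Defs
open import Data.Nat using (ℕ; zero; suc; _+_; _∸_; _≤_; _<_; z≤n; s≤s; _≤?_; _<?_)
open import Data.Nat.Properties
open import Data.Fin using (Fin; zero; suc; toℕ; fromℕ; inject₁; fromℕ<)
open import Data.Fin.Properties using (toℕ-injective; toℕ<n; toℕ≤pred[n]; toℕ-fromℕ; toℕ-fromℕ<; toℕ-inject₁)
open import Data.Bool using (Bool; true; false; _∧_; T) renaming (_≟_ to _≟ᵇ_)
open import Data.Bool.Properties using (∧-conicalˡ; ∧-conicalʳ; T-≡; ¬-not)
open import Data.Product using (Σ; ∃-syntax; _×_; _,_; proj₁; proj₂)
open import Data.Sum using (_⊎_; inj₁; inj₂; [_,_]′)
open import Data.Empty using (⊥; ⊥-elim)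
open import Function.Bundles using (Equivalence)
open import Relation.Nullary using (yes; no)
open import Relation.Nullary.Decidable using (toWitness; fromWitness)
open import Relation.Binary using (tri<; tri≈; tri>)
open import Relation.Binary.PropositionalEquality

fromT : ∀ {b} → T b → b ≡ true
fromT = Equivalence.to T-≡

toT : ∀ {b} → b ≡ true → T b
toT = Equivalence.from T-≡

∧-intro : ∀ {a b} → a ≡ true → b ≡ true → a ∧ b ≡ true
∧-intro refl q = q

true-iff-≡ : ∀ {a b} → (a ≡ true → b ≡ true) → (b ≡ true → a ≡ true) → a ≡ b
true-iff-≡ {false} {false} _ _ = refl
true-iff-≡ {false} {true}  _ g = g refl
true-iff-≡ {true}  {false} f _ = sym (f refl)
true-iff-≡ {true}  {true}  _ _ = refl

allF-elim : ∀ {m} (f : Fin m → Bool) → allF f ≡ true → ∀ i → f i ≡ true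
allF-elim f p zero    = ∧-conicalˡ _ _ p
allF-elim f p (suc i) = allF-elim (λ j → f (suc j)) (∧-conicalʳ _ _ p) i

allF-intro : ∀ {m} (f : Fin m → Bool) → (∀ i → f i ≡ true) → allF f ≡ true
allF-intro {zero}  f h = refl
allF-intro {suc m} f h = ∧-intro (h zero) (allF-intro (λ j → f (suc j)) (λ j → h (suc j)))

countF-cong : ∀ {m} {f g : Fin m → Bool} → f ≗ g → countF f ≡ countF g
countF-cong {zero}  f≗g = refl
countF-cong {suc m} f≗g rewrite f≗g zero = cong (_ +_) (countF-cong (λ j → f≗g (suc j)))

extendUpTo : ∀ {Q : ℕ → Set} {L} → (∀ k → k ≤ L → Q k) → Q (suc L) → ∀ k → k ≤ suc L → Q k
extendUpTo h q k k≤1+L with m<1+n⇒m<n∨m≡n (s≤s k≤1+L)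
... | inj₁ k<1+L = h k (≤-pred k<1+L)
... | inj₂ refl  = q

argmin : (f : ℕ → ℕ) (L : ℕ) → ∃[ t ] (t ≤ L × (∀ k → k ≤ L → f t ≤ f k))
argmin f zero = 0 , z≤n , λ { .0 z≤n → ≤-refl }
argmin f (suc L) with argmin f L
... | t , t≤L , min with f t ≤? f (suc L)
...   | yes le = t , m≤n⇒m≤1+n t≤L , extendUpTo min le
...   | no  gt = suc L , ≤-refl , extendUpTo (λ k k≤L → ≤-trans (<⇒≤ (≰⇒> gt)) (min k k≤L)) ≤-refl

NoPeak : (ℕ → ℕ) → ℕ → Set
NoPeak f L = ∀ a b → b ≤ L → suc a < b →
  (∀ k → a < k → k < b → f k ≡ f (suc a)) → f a < f (suc a) → f b < f (suc a) → ⊥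

data Profile (f : ℕ → ℕ) (L : ℕ) : Set where
  maxAtStart : (∀ k → k ≤ L → f k ≤ f 0) → Profile f L
  risesToEnd : ∀ a → a < L → f a < f (suc a) →
               (∀ k → k ≤ L → a < k → f k ≡ f (suc a)) →
               (∀ k → k ≤ L → f k ≤ f (suc a)) → Profile f L

-- Induction on L: the new value f (L+1) either
-- stays below the old maximum (then it ends a peak, unless the maximum was at 0),
-- continues the final run, or becomes the new maximum.
profile : ∀ {f} L → NoPeak f L → Profile f L
profile zero _ = maxAtStart λ { .0 z≤n → ≤-refl }
profile {f} (suc L) noPeak with profile L (λ a b b≤L → noPeak a b (m≤n⇒m≤1+n b≤L))
... | maxAtStart max with f (suc L) ≤? f 0
...   | yes le = maxAtStart (extendUpTo max le)
...   | no  gt = risesToEnd L ≤-refl (≤-<-trans (max L ≤-refl) (≰⇒> gt)) onlyLast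
                   (extendUpTo (λ k k≤L → ≤-trans (max k k≤L) (<⇒≤ (≰⇒> gt))) ≤-refl)
  where
  onlyLast : ∀ k → k ≤ suc L → L < k → f k ≡ f (suc L)
  onlyLast k k≤1+L L<k = cong f (≤-antisym k≤1+L L<k)
profile {f} (suc L) noPeak | risesToEnd a a<L rise run max with <-cmp (f (suc L)) (f (suc a))
... | tri< fall _ _ =
  ⊥-elim (noPeak a (suc L) ≤-refl (s≤s a<L) (λ k a<k k<1+L → run k (≤-pred k<1+L) a<k) rise fall)
... | tri≈ _ same _ =
  risesToEnd a (m<n⇒m<1+n a<L) rise (extendUpTo run (λ _ → same)) (extendUpTo max (≤-reflexive same))
... | tri> _ _ grow =
  risesToEnd L ≤-refl (subst (_< f (suc L)) (sym (run L ≤-refl a<L)) grow) onlyLast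
    (extendUpTo (λ k k≤L → ≤-trans (max k k≤L) (<⇒≤ grow)) ≤-refl)
  where
  onlyLast : ∀ k → k ≤ suc L → L < k → f k ≡ f (suc L)
  onlyLast k k≤1+L L<k = cong f (≤-antisym k≤1+L L<k)

maxAtAnEnd : ∀ {f L} → Profile f L → (∀ k → k ≤ L → f k ≤ f 0) ⊎ (∀ k → k ≤ L → f k ≤ f L)
maxAtAnEnd (maxAtStart max) = inj₁ max
maxAtAnEnd (risesToEnd a a<L _ run max) =
  inj₂ (λ k k≤L → ≤-trans (max k k≤L) (≤-reflexive (sym (run _ ≤-refl a<L))))

toℕ-nonzero : ∀ {m} (i : Fin (suc m)) → i ≢ zero → 0 < toℕ i
toℕ-nonzero zero    i≢0 = ⊥-elim (i≢0 refl)
toℕ-nonzero (suc i) _   = s≤s z≤n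

module _ (G : ColoredGraph) where
  open ColoredGraph G

  neighboursIn : ℕ → Fin n → Fin n → ℕ
  neighboursIn i u w = countF (λ a → adj u a ∧ refine G i a w)

  refine-step⁻ : ∀ {i u v} → refine G (suc i) u v ≡ true →
    refine G i u v ≡ true × (∀ w → neighboursIn i u w ≡ neighboursIn i v w)
  refine-step⁻ p = ∧-conicalˡ _ _ p , λ w → ≡ᵇ⇒≡ _ _ (toT (allF-elim _ (∧-conicalʳ _ _ p) w))

  refine-step⁺ : ∀ {i u v} → refine G i u v ≡ true →
    (∀ w → neighboursIn i u w ≡ neighboursIn i v w) → refine G (suc i) u v ≡ true
  refine-step⁺ p counts = ∧-intro p (allF-intro _ (λ w → fromT (≡⇒≡ᵇ _ _ (counts w))))

  refine-refl : ∀ i u → refine G i u u ≡ true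
  refine-refl zero    u = fromT (fromWitness refl)
  refine-refl (suc i) u = refine-step⁺ {i} (refine-refl i u) (λ _ → refl)

  refine-sym : ∀ i {u v} → refine G i u v ≡ true → refine G i v u ≡ true
  refine-sym zero    p = fromT (fromWitness (sym (toWitness (toT p))))
  refine-sym (suc i) p with refine-step⁻ {i} p
  ... | p₀ , counts = refine-step⁺ {i} (refine-sym i p₀) (λ w → sym (counts w))

  refine-trans : ∀ i {u v w} → refine G i u v ≡ true → refine G i v w ≡ true → refine G i u w ≡ true
  refine-trans zero    p q = fromT (fromWitness (trans (toWitness (toT p)) (toWitness (toT q))))
  refine-trans (suc i) p q with refine-step⁻ {i} p | refine-step⁻ {i} q
  ... | p₀ , countsp | q₀ , countsq =
    refine-step⁺ {i} (refine-trans i p₀ q₀) (λ z → trans (countsp z) (countsq z))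

  _≈ᶜ_ : Fin n → Fin n → Set
  x ≈ᶜ y = SameCell G x y ≡ true

  ≈ᶜ-refl : ∀ {x} → x ≈ᶜ x
  ≈ᶜ-refl = refine-refl n _

  ≈ᶜ-sym : ∀ {x y} → x ≈ᶜ y → y ≈ᶜ x
  ≈ᶜ-sym = refine-sym n

  ≈ᶜ-trans : ∀ {x y z} → x ≈ᶜ y → y ≈ᶜ z → x ≈ᶜ z
  ≈ᶜ-trans = refine-trans n

  size : Fin n → ℕ
  size = ∣_∣ᶜ G

  size-resp : ∀ {x x'} → x ≈ᶜ x' → size x ≡ size x'
  size-resp {x} {x'} x≈x' = countF-cong {f = SameCell G x} {g = SameCell G x'} λ w →
    true-iff-≡ (≈ᶜ-trans (≈ᶜ-sym x≈x')) (≈ᶜ-trans x≈x')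

  distinct-resp : ∀ {x x' y} → x ≈ᶜ x' → DistinctCells G x y → DistinctCells G x' y
  distinct-resp {x} {x'} {y} x≈x' x≉y with SameCell G x' y in x'≈y
  ... | false = refl
  ... | true  = trans (sym (≈ᶜ-trans x≈x' x'≈y)) x≉y

  distinct-sym : ∀ {x y} → DistinctCells G x y → DistinctCells G y x
  distinct-sym {x} {y} x≉y with SameCell G y x in y≈x
  ... | false = refl
  ... | true  = trans (sym (≈ᶜ-sym y≈x)) x≉y

  isotropic-resp : ∀ {x x' y} → x ≈ᶜ x' → Isotropic G x' y → Isotropic G x y
  isotropic-resp x≈x' (inj₁ full)  = inj₁ λ u v u∈x v∈y → full u v (≈ᶜ-trans (≈ᶜ-sym x≈x') u∈x) v∈y
  isotropic-resp x≈x' (inj₂ empty) = inj₂ λ u v u∈x v∈y → empty u v (≈ᶜ-trans (≈ᶜ-sym x≈x') u∈x) v∈y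

  isotropic-sym : ∀ {x y} → Isotropic G x y → Isotropic G y x
  isotropic-sym (inj₁ full)  = inj₁ λ u v u∈y v∈x → trans (adj-sym u v) (full v u v∈x u∈y)
  isotropic-sym (inj₂ empty) = inj₂ λ u v u∈y v∈x → trans (adj-sym u v) (empty v u v∈x u∈y)

  aniso-respˡ : ∀ {x x' y} → x ≈ᶜ x' → Aniso G x y → Aniso G x' y
  aniso-respˡ x≈x' (x≉y , aniso) = distinct-resp x≈x' x≉y , λ iso → aniso (isotropic-resp x≈x' iso)

  aniso-sym : ∀ {x y} → Aniso G x y → Aniso G y x
  aniso-sym (x≉y , aniso) = distinct-sym x≉y , λ iso → aniso (isotropic-sym iso)

  aniso-respʳ : ∀ {x y y'} → y ≈ᶜ y' → Aniso G x y → Aniso G x y'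
  aniso-respʳ y≈y' x~y = aniso-sym (aniso-respˡ y≈y' (aniso-sym x~y))

  hetero-resp : ∀ {x x'} → x ≈ᶜ x' → Heterogeneous G x → Heterogeneous G x'
  hetero-resp x≈x' hetx hom' = hetx (homogeneous x≈x' hom')
    where
    homogeneous : ∀ {x x'} → x ≈ᶜ x' → Homogeneous G x' → Homogeneous G x
    homogeneous x≈x' (inj₁ full)  = inj₁ λ u v u∈x v∈x →
      full u v (≈ᶜ-trans (≈ᶜ-sym x≈x') u∈x) (≈ᶜ-trans (≈ᶜ-sym x≈x') v∈x)
    homogeneous x≈x' (inj₂ empty) = inj₂ λ u v u∈x v∈x →
      empty u v (≈ᶜ-trans (≈ᶜ-sym x≈x') u∈x) (≈ᶜ-trans (≈ᶜ-sym x≈x') v∈x)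

  reach-resp : ∀ {a b c} → Reach G a b → b ≈ᶜ c → Reach G a c
  reach-resp (here a≈b)     b≈c = here (≈ᶜ-trans a≈b b≈c)
  reach-resp (step reach e) b≈c = step reach (aniso-respʳ b≈c e)

  reach-trans : ∀ {a b c} → Reach G a b → Reach G b c → Reach G a c
  reach-trans r (here b≈c)      = reach-resp r b≈c
  reach-trans r (step r' x~c)   = step (reach-trans r r') x~c

  reach-sym : ∀ {a b} → Reach G a b → Reach G b a
  reach-sym (here a≈b)     = here (≈ᶜ-sym a≈b)
  reach-sym (step r x~b)   = reach-trans (step (here ≈ᶜ-refl) (aniso-sym x~b)) (reach-sym r)

  -- Anisotropic paths and cycles indexed by ℕ (values beyond the length are irrelevant).
  -- They are the working representation; the Fin-indexed ones of Defs are converted.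

  ℕPath : ℕ → (ℕ → Fin n) → Set
  ℕPath L P = (∀ i j → i ≤ L → j ≤ L → i ≢ j → DistinctCells G (P i) (P j))
            × (∀ i → i < L → Aniso G (P i) (P (suc i)))

  ℕCycle : ℕ → (ℕ → Fin n) → Set
  ℕCycle m P = 2 ≤ m × ℕPath m P × Aniso G (P m) (P 0)

  finite : (L : ℕ) → (ℕ → Fin n) → Fin (suc L) → Fin n
  finite L P i = P (toℕ i)

  toAnisoPath : ∀ {L P} → ℕPath L P → AnisoPath G (finite L P)
  toAnisoPath {L} {P} (distinct , edges) =
    (λ i j i≢j → distinct _ _ (toℕ≤pred[n] i) (toℕ≤pred[n] j) (λ eq → i≢j (toℕ-injective eq))) ,
    (λ i → subst (λ t → Aniso G (P t) (P (suc (toℕ i)))) (sym (toℕ-inject₁ i)) (edges _ (toℕ<n i)))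

  toAnisoCycle : ∀ {m P} → ℕCycle m P → AnisoCycle G (finite m P)
  toAnisoCycle {m} {P} (2≤m , path , closing) =
    2≤m , toAnisoPath path , subst (λ t → Aniso G (P t) (P 0)) (sym (toℕ-fromℕ m)) closing

  extend : ∀ {m} → (Fin (suc m) → Fin n) → ℕ → Fin n
  extend {m} p k with k <? suc m
  ... | yes k<1+m = p (fromℕ< k<1+m)
  ... | no  _     = p zero

  extend-at : ∀ {m} (p : Fin (suc m) → Fin n) (i : Fin (suc m)) {k} → toℕ i ≡ k → extend p k ≡ p i
  extend-at {m} p i {k} i≡k with k <? suc m
  ... | yes k<1+m = cong p (toℕ-injective (trans (toℕ-fromℕ< k<1+m) (sym i≡k)))
  ... | no  k≮1+m = ⊥-elim (k≮1+m (subst (_< suc m) i≡k (toℕ<n i)))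

  index : ∀ {m k} → k ≤ m → Fin (suc m)
  index k≤m = fromℕ< (s≤s k≤m)

  extend-index : ∀ {m} (p : Fin (suc m) → Fin n) {k} (k≤m : k ≤ m) → extend p k ≡ p (index k≤m)
  extend-index p k≤m = extend-at p (index k≤m) (toℕ-fromℕ< (s≤s k≤m))

  fromAnisoPath : ∀ {m} {p : Fin (suc m) → Fin n} → AnisoPath G p → ℕPath m (extend p)
  fromAnisoPath {m} {p} (distinct , edges) = distinct' , edges'
    where
    distinct' : ∀ i j → i ≤ m → j ≤ m → i ≢ j → DistinctCells G (extend p i) (extend p j)
    distinct' i j i≤m j≤m i≢j rewrite extend-index p i≤m | extend-index p j≤m =
      distinct _ _ λ eq → i≢j (trans (sym (toℕ-fromℕ< (s≤s i≤m))) (trans (cong toℕ eq) (toℕ-fromℕ< (s≤s j≤m))))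
    edges' : ∀ i → i < m → Aniso G (extend p i) (extend p (suc i))
    edges' i i<m rewrite extend-at p (inject₁ (fromℕ< i<m)) (trans (toℕ-inject₁ (fromℕ< i<m)) (toℕ-fromℕ< i<m))
                       | extend-at p (suc (fromℕ< i<m)) (cong suc (toℕ-fromℕ< i<m)) = edges (fromℕ< i<m)

  fromAnisoCycle : ∀ {m} {p : Fin (suc m) → Fin n} → AnisoCycle G p → ℕCycle m (extend p)
  fromAnisoCycle {m} {p} (2≤m , path , closing)
    rewrite sym (extend-at p (fromℕ m) (toℕ-fromℕ m)) | sym (extend-at p zero {0} refl) =
    2≤m , fromAnisoPath path , closing

  shift : ℕ → (ℕ → Fin n) → ℕ → Fin n
  shift a P k = P (a + k)

  segment : ∀ {L P} a {l} → ℕPath L P → a + l ≤ L → ℕPath l (shift a P)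
  segment {L} {P} a (distinct , edges) a+l≤L =
    (λ i j i≤l j≤l i≢j → distinct _ _ (inside i≤l) (inside j≤l) (λ eq → i≢j (+-cancelˡ-≡ a _ _ eq))) ,
    (λ i i<l → subst (λ t → Aniso G (P (a + i)) (P t)) (sym (+-suc a i))
                 (edges _ (subst (_≤ L) (+-suc a i) (inside i<l))))
    where
    inside : ∀ {i} → i ≤ _ → a + i ≤ L
    inside i≤l = ≤-trans (+-monoʳ-≤ a i≤l) a+l≤L

  prefix : ∀ {L P} l → ℕPath L P → l ≤ L → ℕPath l P
  prefix l (distinct , edges) l≤L =
    (λ i j i≤l j≤l → distinct i j (≤-trans i≤l l≤L) (≤-trans j≤l l≤L)) ,
    (λ i i<l → edges i (<-≤-trans i<l l≤L))

  snoc : ℕ → (ℕ → Fin n) → Fin n → ℕ → Fin n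
  snoc L P y k with k ≤? L
  ... | yes _ = P k
  ... | no  _ = y

  snoc-before : ∀ {L P y k} → k ≤ L → snoc L P y k ≡ P k
  snoc-before {L} {k = k} k≤L with k ≤? L
  ... | yes _   = refl
  ... | no  k≰L = ⊥-elim (k≰L k≤L)

  snoc-last : ∀ {L P y} → snoc L P y (suc L) ≡ y
  snoc-last {L} with suc L ≤? L
  ... | yes 1+L≤L = ⊥-elim (<-irrefl refl 1+L≤L)
  ... | no  _     = refl

  snocPath : ∀ {L P y} → ℕPath L P → (∀ k → k ≤ L → DistinctCells G (P k) y) →
    Aniso G (P L) y → ℕPath (suc L) (snoc L P y)
  snocPath {L} {P} {y} (distinct , edges) new lastEdge = distinct' , edges'
    where
    distinct' : ∀ i j → i ≤ suc L → j ≤ suc L → i ≢ j → DistinctCells G (snoc L P y i) (snoc L P y j)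
    distinct' i j i≤1+L j≤1+L i≢j with i ≤? L | j ≤? L
    ... | yes i≤L | yes j≤L = distinct i j i≤L j≤L i≢j
    ... | yes i≤L | no  _   = new i i≤L
    ... | no  _   | yes j≤L = distinct-sym (new j j≤L)
    ... | no  i≰L | no  j≰L = ⊥-elim (i≢j (trans (≤-antisym i≤1+L (≰⇒> i≰L)) (sym (≤-antisym j≤1+L (≰⇒> j≰L)))))
    edges' : ∀ i → i < suc L → Aniso G (snoc L P y i) (snoc L P y (suc i))
    edges' i i<1+L with m<1+n⇒m<n∨m≡n i<1+L
    ... | inj₁ i<L rewrite snoc-before {L} {P} {y} (<⇒≤ i<L) | snoc-before {L} {P} {y} i<L = edges i i<L
    ... | inj₂ refl rewrite snoc-before {i} {P} {y} (≤-refl {i}) | snoc-last {i} {P} {y} = lastEdge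

  pathReach : ∀ {L P r} → ℕPath L P → Reach G r (P 0) → ∀ k → k ≤ L → Reach G r (P k)
  pathReach path r0 zero    _     = r0
  pathReach path r0 (suc k) k<L = step (pathReach path r0 k (<⇒≤ k<L)) (proj₂ path k k<L)

  -- Every reachable cell is reached by a simple path: extend a simple path to x by the
  -- edge x y, or cut it at the first visit of the cell of y.
  simplePath : ∀ {a b} → Reach G a b →
    ∃[ L ] Σ (ℕ → Fin n) λ P → ℕPath L P × P 0 ≡ a × P L ≈ᶜ b
  simplePath {a} (here a≈b) =
    0 , (λ _ → a) , ((λ { .0 .0 z≤n z≤n 0≢0 → ⊥-elim (0≢0 refl) }) , (λ _ ())) , refl , a≈b
  simplePath (step {x} {y} reach x~y) with simplePath reach
  ... | L , P , path , P0≡a , PL≈x with anyUpTo? (λ k → SameCell G (P k) y ≟ᵇ true) (suc L)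
  ...   | yes (k , k<1+L , Pk≈y) = k , P , prefix k path (≤-pred k<1+L) , P0≡a , Pk≈y
  ...   | no  unvisited =
    suc L , snoc L P y ,
    snocPath path (λ k k≤L → ¬-not λ Pk≈y → unvisited (k , s≤s k≤L , Pk≈y)) (aniso-respˡ (≈ᶜ-sym PL≈x) x~y) ,
    trans (snoc-before {L} {P} {y} z≤n) P0≡a , subst (_≈ᶜ y) (sym (snoc-last {L} {P} {y})) ≈ᶜ-refl

  rotate : ℕ → (ℕ → Fin n) → ℕ → Fin n
  rotate m P zero    = P m
  rotate m P (suc k) = P k

  rotate-cycle : ∀ {m P} → ℕCycle m P → ℕCycle m (rotate m P)
  rotate-cycle {suc m} {P} (2≤m , (distinct , edges) , closing) = 2≤m , (distinct' , edges') , edges m ≤-refl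
    where
    distinct' : ∀ i j → i ≤ suc m → j ≤ suc m → i ≢ j → DistinctCells G (rotate (suc m) P i) (rotate (suc m) P j)
    distinct' zero    zero    _ _ i≢j = ⊥-elim (i≢j refl)
    distinct' zero    (suc j) _ j<  _ = distinct (suc m) j ≤-refl (m≤n⇒m≤1+n (≤-pred j<)) (λ eq → <-irrefl (sym eq) j<)
    distinct' (suc i) zero    i<  _ _ = distinct i (suc m) (m≤n⇒m≤1+n (≤-pred i<)) ≤-refl (λ eq → <-irrefl eq i<)
    distinct' (suc i) (suc j) i<  j< i≢j =
      distinct i j (m≤n⇒m≤1+n (≤-pred i<)) (m≤n⇒m≤1+n (≤-pred j<)) (λ eq → i≢j (cong suc eq))
    edges' : ∀ i → i < suc m → Aniso G (rotate (suc m) P i) (rotate (suc m) P (suc i))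
    edges' zero    _   = closing
    edges' (suc i) i<  = edges i (m<n⇒m<1+n (≤-pred i<))

  rotations : ℕ → ℕ → (ℕ → Fin n) → ℕ → Fin n
  rotations m zero    P = P
  rotations m (suc j) P = rotate m (rotations m j P)

  rotations-cycle : ∀ {m P} j → ℕCycle m P → ℕCycle m (rotations m j P)
  rotations-cycle zero    cycle = cycle
  rotations-cycle (suc j) cycle = rotate-cycle (rotations-cycle j cycle)

  rotations-shift : ∀ {m} (P : ℕ → Fin n) j k → j ≤ k → rotations m j P k ≡ P (k ∸ j)
  rotations-shift P zero    k       _   = refl
  rotations-shift P (suc j) (suc k) j≤k = rotations-shift P j k (≤-pred j≤k)

  rotations-front : ∀ {m} (P : ℕ → Fin n) t → t ≤ m → rotations m (suc (m ∸ t)) P 0 ≡ P t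
  rotations-front {m} P t t≤m = trans (rotations-shift P (m ∸ t) m (m∸n≤m m t)) (cong P (m∸[m∸n]≡n t≤m))

  rotations-all : ∀ {m} (Q : Fin n → Set) {P} → (∀ k → k ≤ m → Q (P k)) →
    ∀ j k → k ≤ m → Q (rotations m j P k)
  rotations-all Q all zero    k       k≤m = all k k≤m
  rotations-all Q all (suc j) zero    _   = rotations-all Q all j _ ≤-refl
  rotations-all Q all (suc j) (suc k) k<m = rotations-all Q all j k (<⇒≤ k<m)

  sizes : (ℕ → Fin n) → ℕ → ℕ
  sizes P k = size (P k)

  noUniformHeteroPath : CondC G → ∀ {L P} → ℕPath L P → 1 ≤ L →
    (∀ k → k ≤ L → size (P k) ≡ size (P 0)) → Heterogeneous G (P 0) → Heterogeneous G (P L) → ⊥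
  noUniformHeteroPath cC {L} {P} path 1≤L uniform het₀ hetL =
    cC L (finite L P) 1≤L (toAnisoPath path)
      (λ i j → trans (uniform _ (toℕ≤pred[n] i)) (sym (uniform _ (toℕ≤pred[n] j)))) het₀
      (subst (λ t → Heterogeneous G (P t)) (sym (toℕ-fromℕ L)) hetL)

  noUniformCycle : CondD G → ∀ {m P} → ℕCycle m P → (∀ k → k ≤ m → size (P k) ≡ size (P 0)) → ⊥
  noUniformCycle cD {m} {P} cycle uniform =
    cD m (finite m P) (toAnisoCycle cycle) λ i j → trans (uniform _ (toℕ≤pred[n] i)) (sym (uniform _ (toℕ≤pred[n] j)))

  noRiseCycle : CondE-cycle G → ∀ {m P M} → ℕCycle m P →
    (∀ k → k ≤ m → 0 < k → size (P k) ≡ M) → size (P 0) < M → ⊥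
  noRiseCycle cE {m} {P} {M} cycle run rise =
    cE m (finite m P) (toAnisoCycle cycle)
      (λ i j i≢0 j≢0 → trans (sizeM i i≢0) (sym (sizeM j j≢0)))
      (λ i i≢0 → subst (size (P 0) <_) (sym (sizeM i i≢0)) rise)
    where
    sizeM : ∀ (i : Fin (suc m)) → i ≢ zero → size (P (toℕ i)) ≡ M
    sizeM i i≢0 = run _ (toℕ≤pred[n] i) (toℕ-nonzero i i≢0)

  segment-first : ∀ {P} a m → finite m (shift a P) zero ≡ P a
  segment-first {P} a m = cong P (+-identityʳ a)

  segment-last : ∀ {P} a m → finite m (shift a P) (fromℕ m) ≡ P (a + m)
  segment-last {P} a m = cong (λ t → P (a + t)) (toℕ-fromℕ m)

  pathNoPeak : CondE-path G → ∀ {L P} → ℕPath L P → NoPeak (sizes P) L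
  pathNoPeak cE {L} {P} path a b b≤L a+1<b run rise fall with m≤n⇒∃[o]m+o≡n (<⇒≤ (<-trans (n<1+n a) a+1<b))
  ... | m , refl =
    cE m (finite m (shift a P)) 2≤m (toAnisoPath (segment a path b≤L))
      (λ i j ii ij → trans (interior i ii) (sym (interior j ij)))
      (λ i ii → subst₂ _<_ (cong size (sym (segment-first {P} a m))) (sym (interior i ii)) rise)
      (λ i ii → subst₂ _<_ (cong size (sym (segment-last {P} a m))) (sym (interior i ii)) fall)
    where
    M = size (P (suc a))
    2≤m : 2 ≤ m
    2≤m = +-cancelˡ-< a 1 m (subst (_< a + m) (+-comm 1 a) a+1<b)
    interior : ∀ (i : Fin (suc m)) → Interior G m i → size (P (a + toℕ i)) ≡ M
    interior i (0<i , i<m) = run _ (m<m+n a 0<i) (+-monoʳ-< a i<m)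

  noRiseToHetero : CondF G → ∀ {L P M} → ℕPath L P → ∀ a → a < L →
    (∀ k → k ≤ L → a < k → size (P k) ≡ M) → size (P a) < M → Heterogeneous G (P L) → ⊥
  noRiseToHetero cF {L} {P} {M} path a a<L run rise hetL with m≤n⇒∃[o]m+o≡n (<⇒≤ a<L)
  ... | m , refl =
    cF m (finite m (shift a P)) 1≤m (toAnisoPath (segment a path ≤-refl))
      (λ i j i≢0 j≢0 → trans (later i i≢0) (sym (later j j≢0)))
      (λ i i≢0 → subst₂ _<_ (cong size (sym (segment-first {P} a m))) (sym (later i i≢0)) rise)
      (subst (Heterogeneous G) (sym (segment-last {P} a m)) hetL)
    where
    1≤m : 1 ≤ m
    1≤m = +-cancelˡ-< a 0 m (subst (_< a + m) (sym (+-identityʳ a)) a<L)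
    later : ∀ (i : Fin (suc m)) → i ≢ zero → size (P (a + toℕ i)) ≡ M
    later i i≢0 = run _ (+-monoʳ-≤ a (toℕ≤pred[n] i)) (m<m+n a (toℕ-nonzero i i≢0))

  -- (H) A heterogeneous cell is minimal in its component: on a simple path from x to R a
  -- final rise into R is excluded by F, so the maximum of the sizes is at x.
  heteroIsMinimal : CondE-path G → CondF G → ∀ {x R} → Reach G x R → Heterogeneous G R → size R ≤ size x
  heteroIsMinimal cE cF reach hetR with simplePath reach
  ... | L , P , path , refl , PL≈R with profile L (pathNoPeak cE path)
  ...   | maxAtStart max = subst (_≤ size (P 0)) (size-resp PL≈R) (max L ≤-refl)
  ...   | risesToEnd a a<L rise run _ =
    ⊥-elim (noRiseToHetero cF path a a<L run rise (hetero-resp (≈ᶜ-sym PL≈R) hetR))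

  -- (H) Two heterogeneous cells of a component coincide: by minimality every cell on a
  -- simple path between them is at least as large as the two (equal-size) ends, and a
  -- maximum sits at an end, so the path is uniform, contradicting C.
  heteroUnique : CondC G → CondE-path G → CondF G → ∀ {x y} → Reach G x y →
    Heterogeneous G x → Heterogeneous G y → x ≈ᶜ y
  heteroUnique cC cE cF reach hetx hety with simplePath reach
  ... | zero  , P , _    , refl , P0≈y = P0≈y
  ... | suc l , P , path , refl , PL≈y =
    ⊥-elim (noUniformHeteroPath cC path (s≤s z≤n) uniform hetx (hetero-resp (≈ᶜ-sym PL≈y) hety))
    where
    L = suc l
    aboveStart : ∀ k → k ≤ L → size (P 0) ≤ size (P k)
    aboveStart k k≤L = heteroIsMinimal cE cF (reach-sym (pathReach path (here ≈ᶜ-refl) k k≤L)) hetx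
    endIsStart : size (P L) ≡ size (P 0)
    endIsStart = ≤-antisym (subst (_≤ size (P 0)) (sym (size-resp PL≈y)) (heteroIsMinimal cE cF reach hety))
                           (aboveStart L ≤-refl)
    uniform : ∀ k → k ≤ L → size (P k) ≡ size (P 0)
    uniform k k≤L with maxAtAnEnd (profile L (pathNoPeak cE path))
    ... | inj₁ max = ≤-antisym (max k k≤L) (aboveStart k k≤L)
    ... | inj₂ max = ≤-antisym (≤-trans (max k k≤L) (≤-reflexive endIsStart)) (aboveStart k k≤L)

  -- (G) Sizes do not decrease along edges directed away from a minimum-size root R: on
  -- the path R … x y a maximum sits at an end, and |R| is below every size.
  rootedMonotone : CondE-path G → ∀ {r} R → Reach G r R → (∀ z → Reach G r z → size R ≤ size z) →
    ∀ x y → RootedEdge G R x y → size x ≤ size y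
  rootedMonotone cE {r} R rR minimal x y (m , p , anisoPath , R≈p₀ , x≈pm , y≈pend) =
    [ viaStart , viaEnd ]′ (maxAtAnEnd (profile (suc m) (pathNoPeak cE path)))
    where
    P = extend p
    path : ℕPath (suc m) P
    path = fromAnisoPath anisoPath
    P₀ : P 0 ≡ p zero
    P₀ = extend-at p zero refl
    size₀ : size (P 0) ≡ size R
    size₀ = trans (cong size P₀) (sym (size-resp R≈p₀))
    sizeX : size (P m) ≡ size x
    sizeX = trans (cong size (extend-at p _ (trans (toℕ-inject₁ (fromℕ m)) (toℕ-fromℕ m)))) (sym (size-resp x≈pm))
    sizeY : size (P (suc m)) ≡ size y
    sizeY = trans (cong size (extend-at p _ (toℕ-fromℕ (suc m)))) (sym (size-resp y≈pend))
    R≤y : size R ≤ size y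
    R≤y = subst (size R ≤_) sizeY
      (minimal _ (pathReach path (subst (Reach G r) (sym P₀) (reach-resp rR R≈p₀)) (suc m) ≤-refl))
    viaStart : (∀ k → k ≤ suc m → size (P k) ≤ size (P 0)) → size x ≤ size y
    viaStart max = ≤-trans (subst₂ _≤_ sizeX size₀ (max m (n≤1+n m))) R≤y
    viaEnd : (∀ k → k ≤ suc m → size (P k) ≤ size (P (suc m))) → size x ≤ size y
    viaEnd max = subst₂ _≤_ sizeX sizeY (max m (n≤1+n m))

  -- If the final run of equal sizes on a cycle starts after position 1 and both the cell
  -- before it and P 0 are smaller, then the run followed by the closing edge to P 0 is a
  -- strict peak on the path P (a+1) … P m P 0, contradicting E.
  peakThroughClosingEdge : CondE-path G → ∀ {m P M} → ℕCycle m P → ∀ a → suc a < m →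
    (∀ k → k ≤ m → suc a < k → size (P k) ≡ M) → size (P (suc a)) < M → size (P 0) < M → ⊥
  peakThroughClosingEdge cE {m} {P} {M} (_ , path , closing) a a+1<m run rise fall
    with m≤n⇒∃[o]m+o≡n (<⇒≤ a+1<m)
  ... | d , refl = pathNoPeak cE path' 0 (suc d) ≤-refl (s≤s 0<d) plateau
                     (subst₂ _<_ (cong size (sym (trans first (cong P (+-identityʳ (suc a))))))
                             (sym (runSize 1 0<d (s≤s z≤n))) rise)
                     (subst₂ _<_ (cong size (sym (snoc-last {d} {Q} {P 0})))
                             (sym (runSize 1 0<d (s≤s z≤n))) fall)
    where
    Q = shift (suc a) P
    path' : ℕPath (suc d) (snoc d Q (P 0))
    path' = snocPath (segment (suc a) path ≤-refl)
              (λ k k≤d → proj₁ path (suc a + k) 0 (+-monoʳ-≤ (suc a) k≤d) z≤n (λ ())) closing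
    first : snoc d Q (P 0) 0 ≡ Q 0
    first = snoc-before {d} {Q} {P 0} z≤n
    0<d : 0 < d
    0<d = +-cancelˡ-< (suc a) 0 d (subst (_< suc a + d) (sym (+-identityʳ (suc a))) a+1<m)
    runSize : ∀ k → k ≤ d → 0 < k → size (snoc d Q (P 0) k) ≡ M
    runSize k k≤d 0<k = trans (cong size (snoc-before {d} {Q} {P 0} k≤d))
                              (run _ (+-monoʳ-≤ (suc a) k≤d) (m<m+n (suc a) 0<k))
    plateau : ∀ k → 0 < k → k < suc d → size (snoc d Q (P 0) k) ≡ size (snoc d Q (P 0) 1)
    plateau k 0<k k<1+d = trans (runSize k (≤-pred k<1+d) 0<k) (sym (runSize 1 0<d (s≤s z≤n)))

  -- A cycle whose first cell has minimum size is impossible: with the maximum at the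
  -- start it is uniform (D); otherwise its final run of maximal sizes begins at 1 (E for
  -- cycles) or later (peak through the closing edge).
  minFirstCycle : CondD G → CondE G → ∀ {m P} → ℕCycle m P →
    (∀ k → k ≤ m → size (P 0) ≤ size (P k)) → ⊥
  minFirstCycle cD (cEp , cEc) {m} {P} cycle min with profile m (pathNoPeak cEp (proj₁ (proj₂ cycle)))
  ... | maxAtStart max = noUniformCycle cD cycle λ k k≤m → ≤-antisym (max k k≤m) (min k k≤m)
  ... | risesToEnd zero    _   rise run _ = noRiseCycle cEc cycle run rise
  ... | risesToEnd (suc a) a<m rise run _ =
    peakThroughClosingEdge cEp cycle a a<m run rise (≤-<-trans (min (suc a) (<⇒≤ a<m)) rise)

  -- (G) There is no anisotropic cycle: rotate a cell of minimum size to the front.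
  noCycle : CondD G → CondE G → ∀ {m P} → ℕCycle m P → ⊥
  noCycle cD cE {m} {P} cycle with argmin (sizes P) m
  ... | t , t≤m , min =
    minFirstCycle cD cE (rotations-cycle j cycle)
      (subst (λ z → ∀ k → k ≤ m → size z ≤ size (rotations m j P k)) (sym (rotations-front P t t≤m))
             (rotations-all (λ z → size (P t) ≤ size z) min j))
    where
    j = suc (m ∸ t)

lemma7 : (G : ColoredGraph) →
    CondA G → CondB G → CondC G → CondD G → CondE G → CondF G →
    (r : Fin (ColoredGraph.n G)) → CondG G r × CondH G r
lemma7 G _ _ cC cD cE cF r =
  ((connected , acyclic) , rootedMonotone G (proj₁ cE)) , (unique , minimal)
  where
  connected : ∀ x y → Reach G r x → Reach G r y → Reach G x y
  connected x y rx ry = reach-trans G (reach-sym G rx) ry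
  acyclic : ∀ m p → AnisoCycle G {m} p → (∀ i → Reach G r (p i)) → ⊥
  acyclic m p cycle _ = noCycle G cD cE (fromAnisoCycle G cycle)
  unique : ∀ x y → Reach G r x → Reach G r y → Heterogeneous G x → Heterogeneous G y → SameCell G x y ≡ true
  unique x y rx ry = heteroUnique G cC (proj₁ cE) cF (connected x y rx ry)
  minimal : ∀ R → Reach G r R → Heterogeneous G R → ∀ x → Reach G r x → ∣_∣ᶜ G R ≤ ∣_∣ᶜ G x
  minimal R rR hetR x rx = heteroIsMinimal G (proj₁ cE) cF (connected x R rx rR) hetR
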